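{- Let $\lambda$ be the POP of size 4 with relations $1>2$ and $1>4$. The only simple permutations of length at least 2 that avoid $\lambda$ are $12$, $21$ and $2413$.
   Context: An $n$-permutation $\pi$ contains $\lambda$ iff there are $i_1<i_2<i_3<i_4$ with $\pi_{i_1}>\pi_{i_2}$ and $\pi_{i_1}>\pi_{i_4}$. An interval of an $n$-permutation is a factor whose values form a set of consecutive integers; it is trivial if its length is $0$, $1$ or $n$; a permutation is simple if all its intervals are trivial. -}

module Defs where

open import Data.Nat using (ℕ; zero; suc; _+_; _<_; _≤_; _>_)
open import Data.Fin using (Fin; toℕ)
open import Data.Fin.Permutation using (Permutation′; _⟨$⟩ʳ_)
open import Data.List using (List; []; _∷_; map)
open import Data.Vec.Functional using (toList)
open import Data.Product using (Σ; ∃; _×_)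
open import Data.Sum using (_⊎_)
open import Relation.Binary.PropositionalEquality using (_≡_)

-- An n-permutation is a bijection Fin n ↔ Fin n; positions and values are
-- 0-based.  The value at position p, as a natural number:
val : ∀ {n} → Permutation′ n → Fin n → ℕ
val π p = toℕ (π ⟨$⟩ʳ p)

ContainsLambda : ∀ {n} → Permutation′ n → Set
ContainsLambda {n} π =
  Σ (Fin n) λ i1 → Σ (Fin n) λ i2 → Σ (Fin n) λ i3 → Σ (Fin n) λ i4 →
    (toℕ i1 < toℕ i2) × (toℕ i2 < toℕ i3) × (toℕ i3 < toℕ i4) ×
    (val π i1 > val π i2) × (val π i1 > val π i4)

AvoidsLambda : ∀ {n} → Permutation′ n → Set
AvoidsLambda π = ContainsLambda π → Data.Empty.⊥
  where import Data.Empty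

-- The factor of π starting at position s with length ℓ (s + ℓ ≤ n) is an
-- interval iff its values form a set of consecutive integers, i.e. (π being
-- injective) all its values lie in some window [a, a + ℓ).
IsInterval : ∀ {n} → Permutation′ n → (s ℓ : ℕ) → Set
IsInterval {n} π s ℓ =
  (s + ℓ ≤ n) ×
  Σ ℕ λ a → (p : Fin n) → s ≤ toℕ p → toℕ p < s + ℓ →
    (a ≤ val π p) × (val π p < a + ℓ)

IsSimple : ∀ {n} → Permutation′ n → Set
IsSimple {n} π = (s ℓ : ℕ) → IsInterval π s ℓ → (ℓ ≡ 0) ⊎ (ℓ ≡ 1) ⊎ (ℓ ≡ n)

-- One-line notation of π (values 1-based as in the paper).
oneLine : ∀ {n} → Permutation′ n → List ℕ
oneLine π = toList (λ p → suc (val π p))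

-- Two entries smaller than π(i) and to its right must sit at adjacent
-- positions, or with the entry between them they form an occurrence of λ;
-- hence there are at most two of them.  In a simple permutation of length
-- at least 3 the first entry is not the minimum (the rest would be an interval),
-- and two adjacent entries cannot carry consecutive values.  Walking along
-- the first entries with these two facts forces the prefix 2 4 1 3, which is
-- an interval, so it is the whole permutation.
module Submission where

open import Defs
open import Data.Nat using (ℕ; suc; _+_; _≤_; _<_; z≤n; s≤s; z<s; s<s; s≤s⁻¹)
open import Data.Nat.Properties
  using (≤-refl; ≤-antisym; <-trans; <-irrefl; <-cmp; ≤-<-trans; <-≤-trans;
         m≤n⇒m<n∨m≡n; ≮⇒≥; n≢0⇒n>0; n≤0⇒n≡0; m≢1+n+m; +-comm; +-cancelˡ-<;
         m+n≤o⇒n≤o; suc-injective; <⇒≤; ≤-trans; m≤m+n; m≤n+m; +-cancelʳ-≤; +-monoˡ-≤; m<m+n; n≤1+n)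
open import Data.Fin using (Fin; toℕ; fromℕ<; #_)
open import Data.Fin.Properties using (toℕ-injective; toℕ<n; toℕ-fromℕ<)
open import Data.Fin.Permutation using (Permutation′; _⟨$⟩ʳ_; _⟨$⟩ˡ_; inverseˡ; inverseʳ)
open import Data.List using ([]; _∷_; length)
open import Data.List.Properties using (length-tabulate)
open import Data.Product using (Σ; _×_; _,_; proj₁; proj₂)
open import Data.Sum using (_⊎_; inj₁; inj₂; swap; map₂)
open import Data.Empty using (⊥; ⊥-elim)
open import Relation.Binary using (tri<; tri≈; tri>)
open import Function using (case_of_)
open import Relation.Binary.PropositionalEquality
  using (_≡_; _≢_; refl; sym; trans; cong; cong₂; subst; subst₂; module ≡-Reasoning)

Adjacent : ℕ → ℕ → Set
Adjacent a b = b ≡ suc a ⊎ a ≡ suc b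

adjacent-sym : ∀ {a b} → Adjacent a b → Adjacent b a
adjacent-sym = swap

adjacent-irrefl : ∀ {a} → Adjacent a a → ⊥
adjacent-irrefl {a} (inj₁ a≡1+a) = m≢1+n+m a a≡1+a
adjacent-irrefl {a} (inj₂ a≡1+a) = m≢1+n+m a a≡1+a

not-adjacent-two-apart : ∀ {a} → Adjacent a (suc (suc a)) → ⊥
not-adjacent-two-apart {a} (inj₁ e) = m≢1+n+m a (sym (suc-injective e))
not-adjacent-two-apart {a} (inj₂ e) = m≢1+n+m a e

no-adjacent-triangle : ∀ {a b c} → Adjacent a b → Adjacent b c → Adjacent a c → ⊥
no-adjacent-triangle (inj₁ refl) (inj₁ refl) ac = not-adjacent-two-apart ac
no-adjacent-triangle (inj₁ refl) (inj₂ refl) ac = adjacent-irrefl ac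
no-adjacent-triangle (inj₂ refl) (inj₁ refl) ac = adjacent-irrefl ac
no-adjacent-triangle (inj₂ refl) (inj₂ refl) ac = not-adjacent-two-apart (adjacent-sym ac)

within-two : ∀ {s r} → s ≤ r → r < s + 2 → r ≡ s ⊎ r ≡ suc s
within-two {s} {r} s≤r r<s+2 with m≤n⇒m<n∨m≡n s≤r
... | inj₂ s≡r = inj₁ (sym s≡r)
... | inj₁ s<r = inj₂ (≤-antisym (s≤s⁻¹ (subst (r <_) (+-comm s 2) r<s+2)) s<r)

adjacent-window : ∀ {x y} → Adjacent x y → Σ ℕ λ a → (a ≤ x × x < a + 2) × (a ≤ y × y < a + 2)
adjacent-window {x} (inj₁ refl) = x , (≤-refl , m<m+n x z<s) , (n≤1+n x , subst (suc x <_) (+-comm 2 x) ≤-refl)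
adjacent-window {_} {y} (inj₂ refl) = y , (n≤1+n y , subst (suc y <_) (+-comm 2 y) ≤-refl) , (≤-refl , m<m+n y z<s)

distinct-in-window-adjacent : ∀ {a x y} → a ≤ x → x < a + 2 → a ≤ y → y < a + 2 → x ≢ y → Adjacent x y
distinct-in-window-adjacent a≤x x<a+2 a≤y y<a+2 x≢y
  with within-two a≤x x<a+2 | within-two a≤y y<a+2
... | inj₁ refl | inj₁ refl = ⊥-elim (x≢y refl)
... | inj₁ refl | inj₂ refl = inj₁ refl
... | inj₂ refl | inj₁ refl = inj₂ refl
... | inj₂ refl | inj₂ refl = ⊥-elim (x≢y refl)

increasing-quadruple-below-4 : ∀ {a b c d} → a < b → b < c → c < d → d < 4 → a ≡ 0 × b ≡ 1
increasing-quadruple-below-4 {a} {b} a<b b<c c<d d<4 = n≤0⇒n≡0 a≤0 , b≡1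
  where
  b≤1 : b ≤ 1
  b≤1 = s≤s⁻¹ (<-≤-trans b<c (s≤s⁻¹ (<-≤-trans c<d (s≤s⁻¹ d<4))))
  b≡1 : b ≡ 1
  b≡1 = ≤-antisym b≤1 (≤-<-trans z≤n a<b)
  a≤0 : a ≤ 0
  a≤0 = s≤s⁻¹ (subst (a <_) b≡1 a<b)

module Entries {n : ℕ} (π : Permutation′ n) where

  val-injective : ∀ {p q} → val π p ≡ val π q → p ≡ q
  val-injective {p} {q} e = begin
    p                    ≡⟨ sym (inverseˡ π) ⟩
    π ⟨$⟩ˡ (π ⟨$⟩ʳ p)    ≡⟨ cong (π ⟨$⟩ˡ_) (toℕ-injective e) ⟩
    π ⟨$⟩ˡ (π ⟨$⟩ʳ q)    ≡⟨ inverseˡ π ⟩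
    q                    ∎
    where open ≡-Reasoning

  position : ∀ x → x < n → Σ (Fin n) λ p → val π p ≡ x
  position x x<n = π ⟨$⟩ˡ fromℕ< x<n , trans (cong toℕ (inverseʳ π)) (toℕ-fromℕ< x<n)

  position-below : ∀ {i x w} → val π i ≡ w → x < w → Σ (Fin n) λ p → val π p ≡ x
  position-below {i} vi x<w = position _ (<-trans (subst (_ <_) (sym vi) x<w) (toℕ<n (π ⟨$⟩ʳ i)))

  same-value : ∀ {p q x} → val π p ≡ x → val π q ≡ x → p ≡ q
  same-value vp vq = val-injective (trans vp (sym vq))

  apart : ∀ {p q x y} → val π p ≡ x → val π q ≡ y → x ≢ y → p ≢ q
  apart vp vq x≢y p≡q = x≢y (trans (sym vp) (trans (cong (val π) p≡q) vq))

  <-by-values : ∀ {p q x y} → val π p ≡ x → val π q ≡ y → x < y → val π p < val π q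
  <-by-values vp vq = subst₂ _<_ (sym vp) (sym vq)

  adjacent-by-values : ∀ {p q x y} → val π p ≡ x → val π q ≡ y → Adjacent x y → Adjacent (val π p) (val π q)
  adjacent-by-values vp vq = subst₂ Adjacent (sym vp) (sym vq)

  interval-values-close : ∀ {s ℓ p q} → IsInterval π s ℓ →
    s ≤ toℕ p → toℕ p < s + ℓ → s ≤ toℕ q → toℕ q < s + ℓ → val π q < val π p + ℓ
  interval-values-close {ℓ = ℓ} (_ , a , window) s≤p p<s+ℓ s≤q q<s+ℓ
    with window _ s≤p p<s+ℓ | window _ s≤q q<s+ℓ
  ... | a≤p , _ | _ , q<a+ℓ = <-≤-trans q<a+ℓ (+-monoˡ-≤ ℓ a≤p)

  neighbours-interval : ∀ {p q} → toℕ q ≡ suc (toℕ p) → Adjacent (val π p) (val π q) →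
    IsInterval π (toℕ p) 2
  neighbours-interval {p} {q} q≡1+p adj with adjacent-window adj
  ... | a , p-in , q-in =
    subst (_≤ n) (+-comm 2 (toℕ p)) (subst (_< n) q≡1+p (toℕ<n q)) , a , window
    where
    window : ∀ r → toℕ p ≤ toℕ r → toℕ r < toℕ p + 2 → a ≤ val π r × val π r < a + 2
    window r p≤r r<p+2 with within-two p≤r r<p+2
    ... | inj₁ r≡p rewrite toℕ-injective r≡p = p-in
    ... | inj₂ r≡1+p rewrite toℕ-injective (trans r≡1+p (sym q≡1+p)) = q-in

  length-2-interval-adjacent : ∀ {p q} → IsInterval π (toℕ p) 2 → toℕ q ≡ suc (toℕ p) →
    Adjacent (val π p) (val π q)
  length-2-interval-adjacent {p} {q} (_ , a , window) q≡1+p =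
    distinct-in-window-adjacent (proj₁ p-in) (proj₂ p-in) (proj₁ q-in) (proj₂ q-in) λ vp≡vq →
      m≢1+n+m (toℕ p) (trans (cong toℕ (val-injective vp≡vq)) q≡1+p)
    where
    p-in : a ≤ val π p × val π p < a + 2
    p-in = window p ≤-refl (m<m+n (toℕ p) z<s)
    q-in : a ≤ val π q × val π q < a + 2
    q-in = window q (subst (toℕ p ≤_) (sym q≡1+p) (n≤1+n (toℕ p)))
                    (subst₂ _<_ (sym q≡1+p) (+-comm 2 (toℕ p)) ≤-refl)

first-zero-suffix-interval : ∀ {k} (π : Permutation′ (suc k)) → val π (# 0) ≡ 0 → IsInterval π 1 k
first-zero-suffix-interval {k} π v₀ = ≤-refl , 1 , window
  where
  open Entries π
  window : ∀ r → 1 ≤ toℕ r → toℕ r < 1 + k → 1 ≤ val π r × val π r < 1 + k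
  window r 1≤r _ =
    n≢0⇒n>0 (λ vr≡0 → <-irrefl refl (subst (λ t → 1 ≤ toℕ t) (same-value vr≡0 v₀) 1≤r)) ,
    toℕ<n (π ⟨$⟩ʳ r)

module LambdaAvoider {n : ℕ} (π : Permutation′ n) (avoids : AvoidsLambda π) where

  later-smaller-consecutive : ∀ {i p q : Fin n} → toℕ i < toℕ p → toℕ p < toℕ q →
    val π p < val π i → val π q < val π i → toℕ q ≡ suc (toℕ p)
  later-smaller-consecutive {i} {p} {q} i<p p<q vp<vi vq<vi with m≤n⇒m<n∨m≡n p<q
  ... | inj₂ 1+p≡q = sym 1+p≡q
  ... | inj₁ 1+p<q = ⊥-elim (avoids (i , p , between , q , i<p , p<between , between<q , vp<vi , vq<vi))
    where
    between : Fin n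
    between = fromℕ< (<-trans 1+p<q (toℕ<n q))
    p<between : toℕ p < toℕ between
    p<between = subst (toℕ p <_) (sym (toℕ-fromℕ< _)) ≤-refl
    between<q : toℕ between < toℕ q
    between<q = subst (_< toℕ q) (sym (toℕ-fromℕ< _)) 1+p<q

  later-smaller-adjacent : ∀ {i p q : Fin n} → toℕ i < toℕ p → toℕ i < toℕ q → p ≢ q →
    val π p < val π i → val π q < val π i → Adjacent (toℕ p) (toℕ q)
  later-smaller-adjacent {p = p} {q} i<p i<q p≢q vp<vi vq<vi with <-cmp (toℕ p) (toℕ q)
  ... | tri< p<q _ _ = inj₁ (later-smaller-consecutive i<p p<q vp<vi vq<vi)
  ... | tri≈ _ p≡q _ = ⊥-elim (p≢q (toℕ-injective p≡q))
  ... | tri> _ _ q<p = inj₂ (later-smaller-consecutive i<q q<p vq<vi vp<vi)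

  at-most-two-later-smaller : ∀ {i p q r : Fin n} → toℕ i < toℕ p → toℕ i < toℕ q → toℕ i < toℕ r →
    p ≢ q → q ≢ r → p ≢ r → val π p < val π i → val π q < val π i → val π r < val π i → ⊥
  at-most-two-later-smaller i<p i<q i<r p≢q q≢r p≢r vp<vi vq<vi vr<vi =
    no-adjacent-triangle (later-smaller-adjacent i<p i<q p≢q vp<vi vq<vi)
                         (later-smaller-adjacent i<q i<r q≢r vq<vi vr<vi)
                         (later-smaller-adjacent i<p i<r p≢r vp<vi vr<vi)

module SimpleAvoider {m : ℕ} (π : Permutation′ (3 + m)) (simple : IsSimple π) (avoids : AvoidsLambda π) where

  open Entries π
  open LambdaAvoider π avoids

  private
    V : Fin (3 + m) → ℕ
    V = val π

  after₀ : ∀ {p : Fin (3 + m)} → p ≢ # 0 → 0 < toℕ p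
  after₀ {Fin.zero} p≢0 = ⊥-elim (p≢0 refl)
  after₀ {Fin.suc _} _ = z<s

  after₁ : ∀ {p : Fin (3 + m)} → p ≢ # 0 → p ≢ # 1 → 1 < toℕ p
  after₁ {Fin.zero} p≢0 _ = ⊥-elim (p≢0 refl)
  after₁ {Fin.suc Fin.zero} _ p≢1 = ⊥-elim (p≢1 refl)
  after₁ {Fin.suc (Fin.suc _)} _ _ = s<s z<s

  after₂ : ∀ {p : Fin (3 + m)} → p ≢ # 0 → p ≢ # 1 → p ≢ # 2 → 2 < toℕ p
  after₂ {Fin.zero} p≢0 _ _ = ⊥-elim (p≢0 refl)
  after₂ {Fin.suc Fin.zero} _ p≢1 _ = ⊥-elim (p≢1 refl)
  after₂ {Fin.suc (Fin.suc Fin.zero)} _ _ p≢2 = ⊥-elim (p≢2 refl)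
  after₂ {Fin.suc (Fin.suc (Fin.suc _))} _ _ _ = s<s (s<s z<s)

  no-proper-interval : ∀ {s ℓ} → IsInterval π s ℓ → 2 ≤ ℓ → ℓ < 3 + m → ⊥
  no-proper-interval {s} {ℓ} I 2≤ℓ ℓ<n with simple s ℓ I
  no-proper-interval I () _ | inj₁ refl
  no-proper-interval I (s≤s ()) _ | inj₂ (inj₁ refl)
  no-proper-interval I _ ℓ<n | inj₂ (inj₂ refl) = <-irrefl refl ℓ<n

  no-consecutive-neighbours : ∀ {p q} → Adjacent (toℕ p) (toℕ q) → Adjacent (V p) (V q) → ⊥
  no-consecutive-neighbours (inj₁ q≡1+p) adj =
    no-proper-interval (neighbours-interval q≡1+p adj) ≤-refl (s<s (s<s z<s))
  no-consecutive-neighbours (inj₂ p≡1+q) adj =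
    no-proper-interval (neighbours-interval p≡1+q (adjacent-sym adj)) ≤-refl (s<s (s<s z<s))

  first-entry : V (# 0) ≡ 1
  first-entry with V (# 0) in v₀
  ... | 0 = ⊥-elim (no-proper-interval (first-zero-suffix-interval π v₀) (s≤s (s≤s z≤n)) ≤-refl)
  ... | 1 = refl
  ... | 2 with position-below v₀ z<s | position-below v₀ (s<s z<s)
  ...   | p , vp | q , vq = ⊥-elim (no-consecutive-neighbours
            (later-smaller-adjacent (after₀ (apart vp v₀ λ ())) (after₀ (apart vq v₀ λ ())) (apart vp vq λ ())
              (<-by-values vp v₀ z<s) (<-by-values vq v₀ (s<s z<s)))
            (adjacent-by-values vp vq (inj₁ refl)))
  first-entry | suc (suc (suc a))
    with position-below v₀ z<s | position-below v₀ (s<s z<s) | position-below v₀ (s<s (s<s z<s))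
  ... | p , vp | q , vq | r , vr = ⊥-elim (at-most-two-later-smaller
        (after₀ (apart vp v₀ λ ())) (after₀ (apart vq v₀ λ ())) (after₀ (apart vr v₀ λ ()))
        (apart vp vq λ ()) (apart vq vr λ ()) (apart vp vr λ ())
        (<-by-values vp v₀ z<s) (<-by-values vq v₀ (s<s z<s)) (<-by-values vr v₀ (s<s (s<s z<s))))

  second-entry : V (# 1) ≡ 3
  second-entry with V (# 1) in v₁
  ... | 0 = ⊥-elim (no-consecutive-neighbours {# 0} {# 1} (inj₁ refl) (adjacent-by-values first-entry v₁ (inj₂ refl)))
  ... | 1 = case same-value v₁ first-entry of λ ()
  ... | 2 = ⊥-elim (no-consecutive-neighbours {# 0} {# 1} (inj₁ refl) (adjacent-by-values first-entry v₁ (inj₁ refl)))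
  ... | 3 = refl
  ... | suc (suc (suc (suc b)))
    with position-below v₁ z<s | position-below v₁ (s<s (s<s z<s)) | position-below v₁ (s<s (s<s (s<s z<s)))
  ...   | p , vp | q , vq | r , vr = ⊥-elim (at-most-two-later-smaller
          (after₁ (apart vp first-entry λ ()) (apart vp v₁ λ ()))
          (after₁ (apart vq first-entry λ ()) (apart vq v₁ λ ()))
          (after₁ (apart vr first-entry λ ()) (apart vr v₁ λ ()))
          (apart vp vq λ ()) (apart vq vr λ ()) (apart vp vr λ ())
          (<-by-values vp v₁ z<s) (<-by-values vq v₁ (s<s (s<s z<s))) (<-by-values vr v₁ (s<s (s<s (s<s z<s)))))

  third-entry : V (# 2) ≡ 0
  third-entry with V (# 2) in v₂
  ... | 0 = refl
  ... | 1 = case same-value v₂ first-entry of λ ()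
  ... | 2 = ⊥-elim (no-consecutive-neighbours {# 1} {# 2} (inj₁ refl) (adjacent-by-values second-entry v₂ (inj₂ refl)))
  ... | 3 = case same-value v₂ second-entry of λ ()
  ... | 4 = ⊥-elim (no-consecutive-neighbours {# 1} {# 2} (inj₁ refl) (adjacent-by-values second-entry v₂ (inj₁ refl)))
  ... | suc (suc (suc (suc (suc c))))
    with position-below v₂ z<s | position-below v₂ (s<s (s<s z<s)) | position-below v₂ (s<s (s<s (s<s (s<s z<s))))
  ...   | p , vp | q , vq | r , vr = ⊥-elim (at-most-two-later-smaller
          (after₂ (apart vp first-entry λ ()) (apart vp second-entry λ ()) (apart vp v₂ λ ()))
          (after₂ (apart vq first-entry λ ()) (apart vq second-entry λ ()) (apart vq v₂ λ ()))
          (after₂ (apart vr first-entry λ ()) (apart vr second-entry λ ()) (apart vr v₂ λ ()))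
          (apart vp vq λ ()) (apart vq vr λ ()) (apart vp vr λ ())
          (<-by-values vp v₂ z<s) (<-by-values vq v₂ (s<s (s<s z<s)))
          (<-by-values vr v₂ (s<s (s<s (s<s (s<s z<s))))))

  position-of-2 : Σ (Fin (3 + m)) λ q → toℕ q ≡ 3 × V q ≡ 2
  position-of-2 with position 2 (s<s (s<s z<s))
  ... | q , vq = q , q≡3 , vq
    where
    q≡3 : toℕ q ≡ 3
    q≡3 = later-smaller-consecutive {# 1} {# 2} {q} (s<s z<s)
      (after₂ (apart vq first-entry λ ()) (apart vq second-entry λ ()) (apart vq third-entry λ ()))
      (<-by-values third-entry second-entry z<s) (<-by-values vq second-entry (s<s (s<s z<s)))

  length-is-four : m ≡ 1
  length-is-four with position-of-2
  ... | q , q≡3 , vq =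
    ≤-antisym (≮⇒≥ prefix-would-be-interval) (+-cancelˡ-< 3 0 m (subst (_< 3 + m) q≡3 (toℕ<n q)))
    where
    prefix-below-4 : ∀ r → toℕ r < 4 → V r < 4
    prefix-below-4 Fin.zero _ = subst (_< 4) (sym first-entry) (s<s z<s)
    prefix-below-4 (Fin.suc Fin.zero) _ = subst (_< 4) (sym second-entry) ≤-refl
    prefix-below-4 (Fin.suc (Fin.suc Fin.zero)) _ = subst (_< 4) (sym third-entry) z<s
    prefix-below-4 (Fin.suc (Fin.suc (Fin.suc r))) (s≤s (s≤s (s≤s (s≤s r≤0)))) =
      subst (λ t → V t < 4) (toℕ-injective (trans q≡3 (cong (3 +_) (sym (n≤0⇒n≡0 r≤0)))))
        (subst (_< 4) (sym vq) (s<s (s<s z<s)))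
    prefix-would-be-interval : 1 < m → ⊥
    prefix-would-be-interval 1<m =
      no-proper-interval {0} (s≤s (s≤s (s≤s (<⇒≤ 1<m))) , 0 , λ r _ r<4 → z≤n , prefix-below-4 r r<4)
        (s≤s (s≤s z≤n)) (s≤s (s≤s (s≤s 1<m)))

Is12-21-or-2413 : ∀ {n} → Permutation′ n → Set
Is12-21-or-2413 π = (oneLine π ≡ 1 ∷ 2 ∷ []) ⊎ (oneLine π ≡ 2 ∷ 1 ∷ []) ⊎ (oneLine π ≡ 2 ∷ 4 ∷ 1 ∷ 3 ∷ [])

length-of-one-line : ∀ {n} (π : Permutation′ n) {xs} → oneLine π ≡ xs → n ≡ length xs
length-of-one-line π refl = sym (length-tabulate (λ p → suc (val π p)))

entries-2413⇒one-line : ∀ {a b c d} → a ≡ 1 → b ≡ 3 → c ≡ 0 → d ≡ 2 →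
  suc a ∷ suc b ∷ suc c ∷ suc d ∷ [] ≡ 2 ∷ 4 ∷ 1 ∷ 3 ∷ []
entries-2413⇒one-line refl refl refl refl = refl

one-line⇒entries-2413 : ∀ {a b c d} → suc a ∷ suc b ∷ suc c ∷ suc d ∷ [] ≡ 2 ∷ 4 ∷ 1 ∷ 3 ∷ [] →
  a ≡ 1 × b ≡ 3 × c ≡ 0 × d ≡ 2
one-line⇒entries-2413 refl = refl , refl , refl , refl

short-simple : ∀ {n} (π : Permutation′ n) → n ≤ 2 → IsSimple π
short-simple π n≤2 s 0 _ = inj₁ refl
short-simple π n≤2 s 1 _ = inj₂ (inj₁ refl)
short-simple π n≤2 s (suc (suc k)) (s+ℓ≤n , _) =
  inj₂ (inj₂ (≤-antisym (m+n≤o⇒n≤o s s+ℓ≤n) (≤-trans n≤2 (m≤m+n 2 k))))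

short-avoids-lambda : ∀ {n} (π : Permutation′ n) → n ≤ 3 → AvoidsLambda π
short-avoids-lambda π n≤3 (_ , _ , _ , i4 , i1<i2 , i2<i3 , i3<i4 , _) =
  <-irrefl refl (<-≤-trans (≤-<-trans 3≤i4 (toℕ<n i4)) n≤3)
  where
  3≤i4 : 3 ≤ toℕ i4
  3≤i4 = ≤-trans (s≤s (≤-trans (s≤s (≤-<-trans z≤n i1<i2)) i2<i3)) i3<i4

length-2-one-line : (π : Permutation′ 2) → (oneLine π ≡ 1 ∷ 2 ∷ []) ⊎ (oneLine π ≡ 2 ∷ 1 ∷ [])
length-2-one-line π
  with within-two {0} z≤n (toℕ<n (π ⟨$⟩ʳ # 0)) | within-two {0} z≤n (toℕ<n (π ⟨$⟩ʳ # 1))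
... | inj₁ v₀ | inj₁ v₁ = case Entries.same-value π v₀ v₁ of λ ()
... | inj₁ v₀ | inj₂ v₁ = inj₁ (cong₂ _∷_ (cong suc v₀) (cong₂ _∷_ (cong suc v₁) refl))
... | inj₂ v₀ | inj₁ v₁ = inj₂ (cong₂ _∷_ (cong suc v₀) (cong₂ _∷_ (cong suc v₁) refl))
... | inj₂ v₀ | inj₂ v₁ = case Entries.same-value π v₀ v₁ of λ ()

2413-simple-avoider : (π : Permutation′ 4) → oneLine π ≡ 2 ∷ 4 ∷ 1 ∷ 3 ∷ [] → IsSimple π × AvoidsLambda π
2413-simple-avoider π one-line with one-line⇒entries-2413 one-line
... | v₀ , v₁ , v₂ , v₃ = simple , avoids
  where
  open Entries π

  -- Every window of length 3 contains positions 1 and 2, whose values 3 and 0 are too far apart.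
  no-interval-of-length-3 : ∀ s → IsInterval π s 3 → ⊥
  no-interval-of-length-3 s I@(s+3≤4 , _) =
    <-irrefl refl (subst₂ (λ x y → x < y + 3) v₁ v₂
      (interval-values-close {p = # 2} {q = # 1} I (≤-trans s≤1 (n≤1+n 1)) (m≤n+m 3 s)
        s≤1 (≤-trans (s≤s (s≤s z≤n)) (m≤n+m 3 s))))
    where
    s≤1 : s ≤ 1
    s≤1 = +-cancelʳ-≤ 3 s 1 s+3≤4

  simple : IsSimple π
  simple s 0 _ = inj₁ refl
  simple s 1 _ = inj₂ (inj₁ refl)
  simple 0 2 I = ⊥-elim (not-adjacent-two-apart (subst₂ Adjacent v₀ v₁ (length-2-interval-adjacent {# 0} {# 1} I refl)))
  simple 1 2 I = case subst₂ Adjacent v₁ v₂ (length-2-interval-adjacent {# 1} {# 2} I refl) of λ { (inj₁ ()) ; (inj₂ ()) }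
  simple 2 2 I = ⊥-elim (not-adjacent-two-apart (subst₂ Adjacent v₂ v₃ (length-2-interval-adjacent {# 2} {# 3} I refl)))
  simple (suc (suc (suc s))) 2 (s≤s (s≤s (s≤s s+2≤1)) , _) with m+n≤o⇒n≤o s s+2≤1
  ... | s≤s ()
  simple s 3 I = ⊥-elim (no-interval-of-length-3 s I)
  simple s 4 _ = inj₂ (inj₂ refl)
  simple s (suc (suc (suc (suc (suc _))))) (s+ℓ≤4 , _) with m+n≤o⇒n≤o s s+ℓ≤4
  ... | s≤s (s≤s (s≤s (s≤s ())))

  avoids : AvoidsLambda π
  avoids (i1 , i2 , _ , i4 , i1<i2 , i2<i3 , i3<i4 , v2<v1 , _)
    with increasing-quadruple-below-4 i1<i2 i2<i3 i3<i4 (toℕ<n i4)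
  ... | i1≡0 , i2≡1 =
    case subst₂ _<_ (trans (cong (val π) (toℕ-injective {j = # 1} i2≡1)) v₁)
                    (trans (cong (val π) (toℕ-injective {j = # 0} i1≡0)) v₀) v2<v1 of λ { (s≤s ()) }

long-simple-avoider-is-2413 : ∀ {m} (π : Permutation′ (3 + m)) → IsSimple π → AvoidsLambda π →
  oneLine π ≡ 2 ∷ 4 ∷ 1 ∷ 3 ∷ []
long-simple-avoider-is-2413 π simple avoids with SimpleAvoider.length-is-four π simple avoids
... | refl = entries-2413⇒one-line first-entry second-entry third-entry fourth-entry
  where
  open SimpleAvoider π simple avoids
  fourth-entry : val π (# 3) ≡ 2
  fourth-entry with position-of-2
  ... | q , q≡3 , vq = subst (λ r → val π r ≡ 2) (toℕ-injective q≡3) vq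

simple-avoider⇒12-21-or-2413 : ∀ {n} → 2 ≤ n → (π : Permutation′ n) →
  IsSimple π → AvoidsLambda π → Is12-21-or-2413 π
simple-avoider⇒12-21-or-2413 {1} (s≤s ()) π _ _
simple-avoider⇒12-21-or-2413 {2} _ π _ _ = map₂ inj₁ (length-2-one-line π)
simple-avoider⇒12-21-or-2413 {suc (suc (suc m))} _ π simple avoids =
  inj₂ (inj₂ (long-simple-avoider-is-2413 π simple avoids))

12-21-or-2413⇒simple-avoider : ∀ {n} (π : Permutation′ n) → Is12-21-or-2413 π → IsSimple π × AvoidsLambda π
12-21-or-2413⇒simple-avoider π (inj₁ one-line) with length-of-one-line π one-line
... | refl = short-simple π ≤-refl , short-avoids-lambda π (s≤s (s≤s z≤n))
12-21-or-2413⇒simple-avoider π (inj₂ (inj₁ one-line)) with length-of-one-line π one-line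
... | refl = short-simple π ≤-refl , short-avoids-lambda π (s≤s (s≤s z≤n))
12-21-or-2413⇒simple-avoider π (inj₂ (inj₂ one-line)) with length-of-one-line π one-line
... | refl = 2413-simple-avoider π one-line

mainTheorem9 : (n : ℕ) → 2 ≤ n → (π : Permutation′ n) →
    ((IsSimple π × AvoidsLambda π) →
      ((oneLine π ≡ 1 ∷ 2 ∷ []) ⊎ (oneLine π ≡ 2 ∷ 1 ∷ []) ⊎ (oneLine π ≡ 2 ∷ 4 ∷ 1 ∷ 3 ∷ [])))
    × (((oneLine π ≡ 1 ∷ 2 ∷ []) ⊎ (oneLine π ≡ 2 ∷ 1 ∷ []) ⊎ (oneLine π ≡ 2 ∷ 4 ∷ 1 ∷ 3 ∷ [])) →
      (IsSimple π × AvoidsLambda π))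
mainTheorem9 n 2≤n π =
  (λ (simple , avoids) → simple-avoider⇒12-21-or-2413 2≤n π simple avoids) , 12-21-or-2413⇒simple-avoider π
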